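{- Every graph $G$ has an independence packing.
   Context: Graphs are finite, simple, undirected; $\alpha$ = independence number. An edge $e$ is critical if $\alpha(G-e)>\alpha(G)$; a graph is critical if all its edges are critical ($K_1$ is critical). An independence packing of $G$ is a collection of vertex-disjoint subgraphs $G_1,\dots,G_k$ of $G$ such that each $G_i$ is connected and critical, $V(G)=\bigcup_{i=1}^k V(G_i)$, and $\alpha(G)=\sum_{i=1}^k\alpha(G_i)$. -}

module Defs where

open import Data.Nat using (ℕ; _≤_; _<_)
open import Data.Bool using (Bool; true; false; if_then_else_; _∨_; _∧_)
open import Data.Fin using (Fin; _≟_)
open import Data.Fin.Subset using (Subset; _∈_; _⊆_; ∣_∣; Nonempty; Empty; _∩_; ⊤)
open import Data.List using (tabulate)
open import Data.Nat.ListAction using (sum)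
open import Data.Product using (Σ; ∃; _×_)
open import Relation.Nullary using (¬_; does)
open import Relation.Binary.PropositionalEquality using (_≡_; _≢_)

record Graph : Set where
  field
    n      : ℕ
    adj    : Fin n → Fin n → Bool
    sym    : ∀ u v → adj u v ≡ adj v u
    irrefl : ∀ v → adj v v ≡ false
open Graph public

-- A graph "living inside" Fin n: a vertex set together with an edge function.
-- (Used both for G itself and for its subgraphs.)
record SGraph (n : ℕ) : Set where
  constructor sgraph
  field
    verts : Subset n
    edge  : Fin n → Fin n → Bool
open SGraph public

whole : (G : Graph) → SGraph (n G)
whole G = sgraph ⊤ (adj G)

IsSubgraph : (G : Graph) → SGraph (n G) → Set
IsSubgraph G H =
  (∀ u v → edge H u v ≡ edge H v u) ×
  (∀ u v → edge H u v ≡ true → (u ∈ verts H) × (v ∈ verts H) × (adj G u v ≡ true))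

Independent : ∀ {n} → SGraph n → Subset n → Set
Independent H I = I ⊆ verts H × (∀ u v → u ∈ I → v ∈ I → edge H u v ≡ false)

IsAlpha : ∀ {n} → SGraph n → ℕ → Set
IsAlpha H k = (∃ λ I → Independent H I × ∣ I ∣ ≡ k) ×
              (∀ I → Independent H I → ∣ I ∣ ≤ k)

deleteEdge : ∀ {n} → SGraph n → Fin n → Fin n → SGraph n
deleteEdge H u v = sgraph (verts H) λ x y →
  if (does (x ≟ u) ∧ does (y ≟ v)) ∨ (does (x ≟ v) ∧ does (y ≟ u))
  then false else edge H x y

CriticalEdge : ∀ {n} → SGraph n → Fin n → Fin n → Set
CriticalEdge H u v = ∀ a b → IsAlpha H a → IsAlpha (deleteEdge H u v) b → a < b

Critical : ∀ {n} → SGraph n → Set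
Critical H = ∀ u v → edge H u v ≡ true → CriticalEdge H u v

data Reach {n} (H : SGraph n) : Fin n → Fin n → Set where
  here : ∀ {u} → Reach H u u
  step : ∀ {u w v} → edge H u w ≡ true → Reach H w v → Reach H u v

Connected : ∀ {n} → SGraph n → Set
Connected H = Nonempty (verts H) × (∀ u v → u ∈ verts H → v ∈ verts H → Reach H u v)

record IndependencePacking (G : Graph) : Set where
  field
    k        : ℕ
    part     : Fin k → SGraph (n G)
    alphas   : Fin k → ℕ
    subgraph : ∀ i → IsSubgraph G (part i)
    disjoint : ∀ i j → i ≢ j → Empty (verts (part i) ∩ verts (part j))
    covers   : ∀ v → ∃ λ i → v ∈ verts (part i)
    connected : ∀ i → Connected (part i)
    critical : ∀ i → Critical (part i)
    alpha-i  : ∀ i → IsAlpha (part i) (alphas i)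
    alpha-G  : IsAlpha (whole G) (sum (tabulate alphas))

module Submission where

-- 1. Pruning.  Inspect every ordered pair (u , v) of vertices once and delete
--    the current edge uv whenever its removal does not increase α.  The result
--    is a spanning subgraph H of G with α(H) = α(G) in which every edge is
--    critical: when uv was inspected and kept, some independent set of the
--    current graph minus uv had more than α(G) vertices, and this set stays
--    independent in H - uv because H only has fewer edges.
-- 2. Components.  The vertex set of H splits into components: closed sets
--    (no edge leaves them) all of whose vertices are reachable from a root.
--    Since no edge joins different components, α(H) = Σ α(H[C]).
-- 3. Criticality is local.  If uv is an edge of the component C and I is an
--    independent set of H - uv with |I| > α(H), then |I \ C| ≤ α(H - C), so
--    |I ∩ C| > α(H[C]) and uv is critical in H[C].
-- The induced subgraphs H[C] on the components form the packing.

open import Defs hiding (sym; irrefl)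
open import Data.Nat using (ℕ; zero; suc; _+_; _∸_; _≤_; _<_; z≤n; _<?_)
open import Data.Nat.Properties
open import Data.Nat.Induction using (<-wellFounded)
open import Data.Nat.ListAction using (sum)
open import Data.Bool using (Bool; true; false; if_then_else_; _∨_; _∧_)
open import Data.Bool.Properties using (∧-comm; ∨-comm) renaming (_≟_ to _≟B_)
open import Data.Fin using (Fin; zero; suc) renaming (_≟_ to _≟F_)
open import Data.Fin.Subset
open import Data.Fin.Subset.Properties
open import Data.Fin.Properties using (all?; any?)
open import Data.Vec using ([]; _∷_; lookup)
open import Data.Vec.Base using (here)
open import Data.Vec.Properties using ([]=⇒lookup; lookup⇒[]=)
open import Data.Vec.Functional using () renaming (_∷_ to _◂_)
open import Data.List using (List; []; _∷_; allFin; cartesianProduct; tabulate)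
open import Data.List.Membership.Propositional using () renaming (_∈_ to _∈L_)
open import Data.List.Membership.Propositional.Properties using (∈-allFin; ∈-cartesianProduct⁺)
open import Data.List.Relation.Unary.Any using (here; there)
open import Data.Product using (Σ; ∃; _×_; _,_; proj₁; proj₂)
open import Data.Sum using (_⊎_; inj₁; inj₂)
open import Function.Base using (_on_)
open import Induction.WellFounded using (Acc; acc)
open import Relation.Binary.Construct.On as On using ()
open import Relation.Nullary using (¬_; Dec; yes; no; does; _×-dec_; _→-dec_; ¬?; contradiction)
open import Relation.Nullary.Decidable using (dec-true; dec-false; decidable-stable)
open import Relation.Binary.PropositionalEquality
  using (_≡_; refl; sym; trans; cong; cong₂; subst; subst₂; _≢_)

∣p∣≡∣p∩q∣+∣p∩∁q∣ : ∀ {n} (p q : Subset n) → ∣ p ∣ ≡ ∣ p ∩ q ∣ + ∣ p ∩ ∁ q ∣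
∣p∣≡∣p∩q∣+∣p∩∁q∣ []         []         = refl
∣p∣≡∣p∩q∣+∣p∩∁q∣ (true ∷ p)  (true ∷ q)  = cong suc (∣p∣≡∣p∩q∣+∣p∩∁q∣ p q)
∣p∣≡∣p∩q∣+∣p∩∁q∣ (true ∷ p)  (false ∷ q) = trans (cong suc (∣p∣≡∣p∩q∣+∣p∩∁q∣ p q)) (sym (+-suc _ _))
∣p∣≡∣p∩q∣+∣p∩∁q∣ (false ∷ p) (true ∷ q)  = ∣p∣≡∣p∩q∣+∣p∩∁q∣ p q
∣p∣≡∣p∩q∣+∣p∩∁q∣ (false ∷ p) (false ∷ q) = ∣p∣≡∣p∩q∣+∣p∩∁q∣ p q

∣p∪q∣≡∣p∣+∣q∣ : ∀ {n} (p q : Subset n) → Empty (p ∩ q) → ∣ p ∪ q ∣ ≡ ∣ p ∣ + ∣ q ∣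
∣p∪q∣≡∣p∣+∣q∣ []          []          _  = refl
∣p∪q∣≡∣p∣+∣q∣ (true ∷ p)  (true ∷ q)  ∅  = contradiction (zero , here) ∅
∣p∪q∣≡∣p∣+∣q∣ (true ∷ p)  (false ∷ q) ∅  = cong suc (∣p∪q∣≡∣p∣+∣q∣ p q (drop-∷-Empty ∅))
∣p∪q∣≡∣p∣+∣q∣ (false ∷ p) (true ∷ q)  ∅  =
  trans (cong suc (∣p∪q∣≡∣p∣+∣q∣ p q (drop-∷-Empty ∅))) (sym (+-suc _ _))
∣p∪q∣≡∣p∣+∣q∣ (false ∷ p) (false ∷ q) ∅  = ∣p∪q∣≡∣p∣+∣q∣ p q (drop-∷-Empty ∅)

+-<-cancel : ∀ {a b j k} → a + b < j + k → k ≤ b → a < j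
+-<-cancel {a} {b} {j} lt k≤b = +-cancelʳ-< b a j (<-≤-trans lt (+-monoʳ-≤ j k≤b))

module _ {n : ℕ} (K : SGraph n) where

  independent? : (I : Subset n) → Dec (Independent K I)
  independent? I = (I ⊆? verts K) ×-dec
    all? (λ u → all? (λ v → (u ∈? I) →-dec ((v ∈? I) →-dec (edge K u v ≟B false))))

  HasIndependent : ℕ → Set
  HasIndependent k = ∃ λ I → Independent K I × ∣ I ∣ ≡ k

  hasIndependent? : (k : ℕ) → Dec (HasIndependent k)
  hasIndependent? k = anySubset? (λ I → independent? I ×-dec (∣ I ∣ ≟ k))

  ∅-independent : HasIndependent 0
  ∅-independent = ⊥ , ((λ x∈⊥ → contradiction x∈⊥ ∉⊥) , (λ _ _ u∈⊥ _ → contradiction u∈⊥ ∉⊥)) , ∣⊥∣≡0 n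

  largestUpTo : (m : ℕ) → Σ ℕ λ k → HasIndependent k × (∀ j → k < j → j ≤ m → ¬ HasIndependent j)
  largestUpTo zero = 0 , ∅-independent , λ j 0<j j≤0 _ → <-irrefl refl (<-≤-trans 0<j j≤0)
  largestUpTo (suc m) with hasIndependent? (suc m) | largestUpTo m
  ... | yes has | _ = suc m , has , λ j m<j j≤m _ → <-irrefl refl (<-≤-trans m<j j≤m)
  ... | no ¬has | k , hasₖ , noneAbove = k , hasₖ , beyond
    where
    beyond : ∀ j → k < j → j ≤ suc m → ¬ HasIndependent j
    beyond j k<j j≤1+m with m≤n⇒m<n∨m≡n j≤1+m
    ... | inj₁ j<1+m = noneAbove j k<j (≤-pred j<1+m)
    ... | inj₂ refl  = ¬has

  -- no independent set has more than n vertices, so this is α(K)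
  α : ℕ
  α = proj₁ (largestUpTo n)

  α-isAlpha : IsAlpha K α
  α-isAlpha = proj₁ (proj₂ (largestUpTo n)) , λ I ind → ≮⇒≥ λ α<∣I∣ →
    proj₂ (proj₂ (largestUpTo n)) ∣ I ∣ α<∣I∣ (∣p∣≤n I) (I , ind , refl)

  α-max : ∀ I → Independent K I → ∣ I ∣ ≤ α
  α-max = proj₂ α-isAlpha

  α-unique : ∀ a → IsAlpha K a → a ≡ α
  α-unique a ((I , ind , ∣I∣≡a) , a-max) with proj₁ α-isAlpha
  ... | J , indJ , ∣J∣≡α =
    ≤-antisym (subst (_≤ α) ∣I∣≡a (α-max I ind)) (subst (_≤ a) ∣J∣≡α (a-max J indJ))

α-mono : ∀ {n} (K K′ : SGraph n) → (∀ I → Independent K I → Independent K′ I) → α K ≤ α K′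
α-mono K K′ f with proj₁ (α-isAlpha K)
... | I , ind , ∣I∣≡α = subst (_≤ α K′) ∣I∣≡α (α-max K′ I (f I ind))

α-empty : ∀ {n} (K : SGraph n) → Empty (verts K) → α K ≡ 0
α-empty {n} K noVertex with proj₁ (α-isAlpha K)
... | I , (I⊆V , _) , ∣I∣≡α =
  trans (sym ∣I∣≡α) (trans (cong ∣_∣ (Empty-unique λ { (x , x∈I) → noVertex (x , I⊆V x∈I) })) (∣⊥∣≡0 n))

critical-by-witness : ∀ {n} (K : SGraph n) u v J →
  Independent (deleteEdge K u v) J → α K < ∣ J ∣ → CriticalEdge K u v
critical-by-witness K u v J indJ α<∣J∣ a b isAlpha-a isAlpha-b
  rewrite α-unique K a isAlpha-a | α-unique (deleteEdge K u v) b isAlpha-b =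
  <-≤-trans α<∣J∣ (α-max (deleteEdge K u v) J indJ)

-- edge relations on Fin n; a spanning subgraph of G is given by its edges
Edges : ℕ → Set
Edges n = Fin n → Fin n → Bool

_⊑_ : ∀ {n} → Edges n → Edges n → Set
e ⊑ e′ = ∀ x y → e x y ≡ true → e′ x y ≡ true

SymmetricEdges : ∀ {n} → Edges n → Set
SymmetricEdges e = ∀ x y → e x y ≡ e y x

spanning : ∀ {n} → Edges n → SGraph n
spanning e = sgraph ⊤ e

⊑-non-edge : ∀ {n} {e e′ : Edges n} → e′ ⊑ e → ∀ x y → e x y ≡ false → e′ x y ≡ false
⊑-non-edge {e′ = e′} e′⊑e x y exy with e′ x y in e′xy
... | false = refl
... | true  = trans (sym (e′⊑e x y e′xy)) exy

independent-⊑ : ∀ {n} (K K′ : SGraph n) → verts K ⊆ verts K′ → edge K′ ⊑ edge K →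
  ∀ {I} → Independent K I → Independent K′ I
independent-⊑ K K′ V⊆V′ e′⊑e (I⊆V , stable) =
  (λ x∈I → V⊆V′ (I⊆V x∈I)) , λ u v u∈I v∈I → ⊑-non-edge e′⊑e u v (stable u v u∈I v∈I)

-- `deleteEdge K u v` removes exactly the pairs (x , y) for which this is true.
isPair : ∀ {n} → Fin n → Fin n → Fin n → Fin n → Bool
isPair u v x y = (does (x ≟F u) ∧ does (y ≟F v)) ∨ (does (x ≟F v) ∧ does (y ≟F u))

isPair-sym : ∀ {n} (u v x y : Fin n) → isPair u v x y ≡ isPair u v y x
isPair-sym u v x y =
  trans (∨-comm (does (x ≟F u) ∧ does (y ≟F v)) _)
        (cong₂ _∨_ (∧-comm (does (x ≟F v)) _) (∧-comm (does (x ≟F u)) _))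

module _ {n : ℕ} (K : SGraph n) (u v : Fin n) where

  delete-⊑ : edge (deleteEdge K u v) ⊑ edge K
  delete-⊑ x y h with isPair u v x y
  delete-⊑ x y () | true
  delete-⊑ x y h  | false = h

  delete-removes : edge (deleteEdge K u v) u v ≡ false
  delete-removes rewrite dec-true (u ≟F u) refl | dec-true (v ≟F v) refl = refl

  delete-away : ∀ x y → x ≢ u → x ≢ v → edge (deleteEdge K u v) x y ≡ edge K x y
  delete-away x y x≢u x≢v rewrite dec-false (x ≟F u) x≢u | dec-false (x ≟F v) x≢v = refl

  delete-sym : SymmetricEdges (edge K) → SymmetricEdges (edge (deleteEdge K u v))
  delete-sym symK x y = cong₂ (λ c b → if c then false else b) (isPair-sym u v x y) (symK x y)

  α-delete-≥ : α K ≤ α (deleteEdge K u v)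
  α-delete-≥ = α-mono K (deleteEdge K u v) (λ I → independent-⊑ K _ (λ x∈ → x∈) delete-⊑)

delete-mono : ∀ {n} (K K′ : SGraph n) u v → edge K′ ⊑ edge K →
  edge (deleteEdge K′ u v) ⊑ edge (deleteEdge K u v)
delete-mono K K′ u v K′⊑K x y h with isPair u v x y
delete-mono K K′ u v K′⊑K x y () | true
delete-mono K K′ u v K′⊑K x y h  | false = K′⊑K x y h

Exceeds : ∀ {n} → Edges n → ℕ → Fin n → Fin n → Set
Exceeds e a u v = ∃ λ I → Independent (deleteEdge (spanning e) u v) I × a < ∣ I ∣

exceeds-⊑ : ∀ {n} {e e′ : Edges n} {a u v} → e′ ⊑ e → Exceeds e a u v → Exceeds e′ a u v
exceeds-⊑ {e = e} {e′} {u = u} {v} e′⊑e (I , (I⊆⊤ , stable) , a<∣I∣) =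
  I , (I⊆⊤ , λ x y x∈I y∈I → ⊑-non-edge (delete-mono (spanning e) (spanning e′) u v e′⊑e) x y
                                          (stable x y x∈I y∈I)) , a<∣I∣

∧³-elim : ∀ a b c → a ∧ b ∧ c ≡ true → a ≡ true × b ≡ true × c ≡ true
∧³-elim true  true  true  _  = refl , refl , refl
∧³-elim true  true  false ()
∧³-elim true  false _     ()
∧³-elim false _     _     ()

∧-swap : ∀ a b {c c′} → c ≡ c′ → a ∧ b ∧ c ≡ b ∧ a ∧ c′
∧-swap true  true  refl = refl
∧-swap true  false refl = refl
∧-swap false true  refl = refl
∧-swap false false refl = refl

induced : ∀ {n} → Edges n → Subset n → SGraph n
induced e C = sgraph C (λ x y → lookup C x ∧ lookup C y ∧ e x y)

Stable : ∀ {n} → Edges n → Subset n → Set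
Stable e I = ∀ u v → u ∈ I → v ∈ I → e u v ≡ false

module _ {n : ℕ} (e : Edges n) {C : Subset n} where

  induced-edge : ∀ {x y} → x ∈ C → y ∈ C → edge (induced e C) x y ≡ e x y
  induced-edge x∈C y∈C rewrite []=⇒lookup x∈C | []=⇒lookup y∈C = refl

  induced-edge⁻ : ∀ {x y} → edge (induced e C) x y ≡ true → x ∈ C × y ∈ C × e x y ≡ true
  induced-edge⁻ {x} {y} h with ∧³-elim (lookup C x) (lookup C y) (e x y) h
  ... | Cx , Cy , exy = lookup⇒[]= x C Cx , lookup⇒[]= y C Cy , exy

  induced-⊑ : edge (induced e C) ⊑ e
  induced-⊑ x y h = proj₂ (proj₂ (induced-edge⁻ h))

  induced-independent⁺ : ∀ {I} → I ⊆ C → Stable e I → Independent (induced e C) I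
  induced-independent⁺ I⊆C stable =
    I⊆C , λ u v u∈I v∈I → trans (induced-edge (I⊆C u∈I) (I⊆C v∈I)) (stable u v u∈I v∈I)

  induced-independent⁻ : ∀ {I} → Independent (induced e C) I → I ⊆ C × Stable e I
  induced-independent⁻ (I⊆C , stable) =
    I⊆C , λ u v u∈I v∈I → trans (sym (induced-edge (I⊆C u∈I) (I⊆C v∈I))) (stable u v u∈I v∈I)

α-spanning : ∀ {n} (e : Edges n) → α (spanning e) ≡ α (induced e ⊤)
α-spanning e = ≤-antisym
  (α-mono _ _ λ I (I⊆⊤ , stable) → induced-independent⁺ e I⊆⊤ stable)
  (α-mono _ _ λ I ind → induced-independent⁻ e ind)

induced-isSubgraph : (G : Graph) (e : Edges (n G)) → SymmetricEdges e → e ⊑ adj G →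
  ∀ C → IsSubgraph G (induced e C)
induced-isSubgraph G e sym-e e⊑G C =
  (λ x y → ∧-swap (lookup C x) (lookup C y) (sym-e x y)) ,
  λ x y h → let x∈C , y∈C , exy = induced-edge⁻ e h in x∈C , y∈C , e⊑G x y exy

module Components {n : ℕ} (e : Edges n) (sym-e : SymmetricEdges e) where

  Closed : Subset n → Set
  Closed C = ∀ x y → x ∈ C → e x y ≡ true → y ∈ C

  closed-no-edge : ∀ {C x y} → Closed C → x ∈ C → y ∉ C → e x y ≡ false
  closed-no-edge {x = x} {y} closed x∈C y∉C with e x y in exy
  ... | true  = contradiction (closed x y x∈C exy) y∉C
  ... | false = refl

  closed-diff : ∀ {S C} → Closed S → Closed C → Closed (S ∩ ∁ C)
  closed-diff {S} {C} closed-S closed-C x y x∈S∖C exy with x∈p∩q⁻ S (∁ C) x∈S∖C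
  ... | x∈S , x∈∁C = x∈p∩q⁺ (closed-S x y x∈S exy , x∉p⇒x∈∁p λ y∈C →
    x∈∁p⇒x∉p x∈∁C (closed-C y x y∈C (trans (sym-e y x) exy)))

  Walk : Fin n → Fin n → Set
  Walk = Reach (spanning e)

  walk-++ : ∀ {u w v} → Walk u w → Walk w v → Walk u v
  walk-++ here         q = q
  walk-++ (step uw p) q = step uw (walk-++ p q)

  walk-reverse : ∀ {u v} → Walk u v → Walk v u
  walk-reverse here         = here
  walk-reverse (step uw p) = walk-++ (walk-reverse p) (step (trans (sym-e _ _) uw) here)

  closed-walk : ∀ {C u w} → Closed C → u ∈ C → Walk u w → w ∈ C
  closed-walk closed u∈C here         = u∈C
  closed-walk closed u∈C (step uw p) = closed-walk closed (closed _ _ u∈C uw) p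

  walk-induced : ∀ {C u w} → Closed C → u ∈ C → Walk u w → Reach (induced e C) u w
  walk-induced closed u∈C here = here
  walk-induced closed u∈C (step uw p) =
    step (trans (induced-edge e u∈C (closed _ _ u∈C uw)) uw)
         (walk-induced closed (closed _ _ u∈C uw) p)

  Escape : Subset n → Set
  Escape C = ∃ λ x → ∃ λ y → x ∈ C × e x y ≡ true × y ∉ C

  closed-or-escape : ∀ C → Closed C ⊎ Escape C
  closed-or-escape C with any? (λ x → any? (λ y → (x ∈? C) ×-dec (e x y ≟B true) ×-dec ¬? (y ∈? C)))
  ... | yes escape = inj₂ escape
  ... | no ¬escape = inj₁ λ x y x∈C exy →
    decidable-stable (y ∈? C) λ y∉C → ¬escape (x , y , x∈C , exy , y∉C)

  Rooted : Fin n → Subset n → Set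
  Rooted v C = v ∈ C × ∀ w → w ∈ C → Walk v w

  Component : Fin n → Set
  Component v = ∃ λ C → Closed C × Rooted v C

  -- Add escaping vertices to a rooted set until it is closed; the number of
  -- vertices outside decreases at each step.
  grow : ∀ {v} T → Acc (_<_ on λ T → n ∸ ∣ T ∣) T → Rooted v T → Component v
  grow T (acc smaller) rooted@(v∈T , walks) with closed-or-escape T
  ... | inj₁ closed = T , closed , rooted
  ... | inj₂ (x , y , x∈T , exy , y∉T) =
    grow (T ∪ ⁅ y ⁆) (smaller fewerOutside) (p⊆p∪q ⁅ y ⁆ v∈T , walks′)
    where
    ∣T∪y∣ : ∣ T ∪ ⁅ y ⁆ ∣ ≡ suc ∣ T ∣
    ∣T∪y∣ = trans (∣p∪q∣≡∣p∣+∣q∣ T ⁅ y ⁆ λ { (z , z∈) → let z∈T , z∈y = x∈p∩q⁻ T ⁅ y ⁆ z∈ in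
                                               y∉T (subst (_∈ T) (x∈⁅y⁆⇒x≡y y z∈y) z∈T) })
                  (trans (cong (∣ T ∣ +_) (∣⁅x⁆∣≡1 y)) (+-comm ∣ T ∣ 1))
    fewerOutside : n ∸ ∣ T ∪ ⁅ y ⁆ ∣ < n ∸ ∣ T ∣
    fewerOutside rewrite ∣T∪y∣ = ∸-monoʳ-< (n<1+n ∣ T ∣) (subst (_≤ n) ∣T∪y∣ (∣p∣≤n (T ∪ ⁅ y ⁆)))
    walks′ : ∀ w → w ∈ T ∪ ⁅ y ⁆ → Walk _ w
    walks′ w w∈ with x∈p∪q⁻ T ⁅ y ⁆ w∈
    ... | inj₁ w∈T = walks w w∈T
    ... | inj₂ w∈y = subst (Walk _) (sym (x∈⁅y⁆⇒x≡y y w∈y)) (walk-++ (walks x x∈T) (step exy here))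

  component : ∀ v → Component v
  component v = grow ⁅ v ⁆ (On.wellFounded _ <-wellFounded ⁅ v ⁆)
    (x∈⁅x⁆ v , λ w w∈ → subst (Walk v) (sym (x∈⁅y⁆⇒x≡y v w∈)) here)

  rooted-connected : ∀ {v C} → Closed C → Rooted v C → Connected (induced e C)
  rooted-connected {v} closed (v∈C , walks) = (v , v∈C) , λ x y x∈C y∈C →
    walk-induced closed x∈C (walk-++ (walk-reverse (walks x x∈C)) (walks y y∈C))

  α-split : ∀ S C → Closed C → C ⊆ S →
    α (induced e S) ≡ α (induced e C) + α (induced e (S ∩ ∁ C))
  α-split S C closed C⊆S = ≤-antisym split-≤ split-≥
    where
    αC αR : ℕ
    αC = α (induced e C)
    αR = α (induced e (S ∩ ∁ C))

    split-≤ : α (induced e S) ≤ αC + αR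
    split-≤ with proj₁ (α-isAlpha (induced e S))
    ... | I , ind , ∣I∣≡α with induced-independent⁻ e ind
    ... | I⊆S , stable = subst (_≤ αC + αR) (trans (sym (∣p∣≡∣p∩q∣+∣p∩∁q∣ I C)) ∣I∣≡α)
      (+-mono-≤ (α-max (induced e C) (I ∩ C) (induced-independent⁺ e (p∩q⊆q I C) (restrict stable)))
                (α-max (induced e (S ∩ ∁ C)) (I ∩ ∁ C) (induced-independent⁺ e rest⊆ (restrict stable))))
      where
      restrict : ∀ {J} → Stable e I → Stable e (I ∩ J)
      restrict st u v u∈ v∈ = st u v (p∩q⊆p I _ u∈) (p∩q⊆p I _ v∈)
      rest⊆ : I ∩ ∁ C ⊆ S ∩ ∁ C
      rest⊆ x∈ = x∈p∩q⁺ (I⊆S (p∩q⊆p I (∁ C) x∈) , p∩q⊆q I (∁ C) x∈)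

    -- independent sets on both sides combine, as no edge leaves C
    split-≥ : αC + αR ≤ α (induced e S)
    split-≥ with proj₁ (α-isAlpha (induced e C)) | proj₁ (α-isAlpha (induced e (S ∩ ∁ C)))
    ... | I₁ , ind₁ , ∣I₁∣≡αC | I₂ , ind₂ , ∣I₂∣≡αR
      with induced-independent⁻ e ind₁ | induced-independent⁻ e ind₂
    ... | I₁⊆C , stable₁ | I₂⊆S∖C , stable₂ =
      subst (_≤ α (induced e S)) (trans (∣p∪q∣≡∣p∣+∣q∣ I₁ I₂ disjoint) (cong₂ _+_ ∣I₁∣≡αC ∣I₂∣≡αR))
            (α-max (induced e S) (I₁ ∪ I₂) (induced-independent⁺ e ⊆S stable))
      where
      outC : ∀ {x} → x ∈ I₂ → x ∉ C
      outC x∈ = x∈∁p⇒x∉p (p∩q⊆q S (∁ C) (I₂⊆S∖C x∈))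
      disjoint : Empty (I₁ ∩ I₂)
      disjoint (x , x∈) = outC (proj₂ (x∈p∩q⁻ I₁ I₂ x∈)) (I₁⊆C (proj₁ (x∈p∩q⁻ I₁ I₂ x∈)))
      ⊆S : I₁ ∪ I₂ ⊆ S
      ⊆S x∈ with x∈p∪q⁻ I₁ I₂ x∈
      ... | inj₁ x∈₁ = C⊆S (I₁⊆C x∈₁)
      ... | inj₂ x∈₂ = p∩q⊆p S (∁ C) (I₂⊆S∖C x∈₂)
      stable : Stable e (I₁ ∪ I₂)
      stable u v u∈ v∈ with x∈p∪q⁻ I₁ I₂ u∈ | x∈p∪q⁻ I₁ I₂ v∈
      ... | inj₁ u∈₁ | inj₁ v∈₁ = stable₁ u v u∈₁ v∈₁
      ... | inj₂ u∈₂ | inj₂ v∈₂ = stable₂ u v u∈₂ v∈₂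
      ... | inj₁ u∈₁ | inj₂ v∈₂ = closed-no-edge closed (I₁⊆C u∈₁) (outC v∈₂)
      ... | inj₂ u∈₂ | inj₁ v∈₁ = trans (sym-e u v) (closed-no-edge closed (I₁⊆C v∈₁) (outC u∈₂))

  record ComponentPartition (S : Subset n) : Set where
    field
      k          : ℕ
      part       : Fin k → Subset n
      closed     : ∀ i → Closed (part i)
      rooted     : ∀ i → ∃ λ v → Rooted v (part i)
      within     : ∀ i → part i ⊆ S
      disjoint   : ∀ i j → i ≢ j → Empty (part i ∩ part j)
      covers     : ∀ x → x ∈ S → ∃ λ i → x ∈ part i
      α-additive : α (induced e S) ≡ sum (tabulate λ i → α (induced e (part i)))

  emptyPartition : ∀ {S} → Empty S → ComponentPartition S
  emptyPartition noVertex = record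
    { k = 0 ; part = λ () ; closed = λ () ; rooted = λ () ; within = λ () ; disjoint = λ ()
    ; covers = λ x x∈S → contradiction (x , x∈S) noVertex
    ; α-additive = α-empty (induced e _) noVertex }

  extendPartition : ∀ {S v} C → Closed C → Rooted v C → C ⊆ S →
    ComponentPartition (S ∩ ∁ C) → ComponentPartition S
  extendPartition {S} {v} C closed-C rooted-C C⊆S P = record
    { k = suc P.k
    ; part = C ◂ P.part
    ; closed = λ { zero → closed-C ; (suc i) → P.closed i }
    ; rooted = λ { zero → v , rooted-C ; (suc i) → P.rooted i }
    ; within = λ { zero → C⊆S ; (suc i) → λ x∈ → p∩q⊆p S (∁ C) (P.within i x∈) }
    ; disjoint = disjoint
    ; covers = covers
    ; α-additive = trans (α-split S C closed-C C⊆S) (cong (α (induced e C) +_) P.α-additive)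
    }
    where
    module P = ComponentPartition P
    outC : ∀ i {x} → x ∈ P.part i → x ∉ C
    outC i x∈ = x∈∁p⇒x∉p (p∩q⊆q S (∁ C) (P.within i x∈))
    disjoint : ∀ i j → i ≢ j → Empty ((C ◂ P.part) i ∩ (C ◂ P.part) j)
    disjoint zero    zero    i≢j _        = i≢j refl
    disjoint zero    (suc j) _   (x , x∈) = outC j (p∩q⊆q C _ x∈) (p∩q⊆p C _ x∈)
    disjoint (suc i) zero    _   (x , x∈) = outC i (p∩q⊆p _ C x∈) (p∩q⊆q _ C x∈)
    disjoint (suc i) (suc j) i≢j         = P.disjoint i j λ i≡j → i≢j (cong suc i≡j)
    covers : ∀ x → x ∈ S → ∃ λ i → x ∈ (C ◂ P.part) i
    covers x x∈S with x ∈? C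
    ... | yes x∈C = zero , x∈C
    ... | no x∉C with P.covers x (x∈p∩q⁺ (x∈S , x∉p⇒x∈∁p x∉C))
    ... | i , x∈ = suc i , x∈

  partition : ∀ S → Acc (_<_ on ∣_∣) S → Closed S → ComponentPartition S
  partition S (acc smaller) closed-S with nonempty? S
  ... | no empty = emptyPartition empty
  ... | yes (v , v∈S) with component v
  ... | C , closed-C , rooted-C@(v∈C , walks) =
    extendPartition C closed-C rooted-C C⊆S
      (partition (S ∩ ∁ C) (smaller fewer) (closed-diff closed-S closed-C))
    where
    C⊆S : C ⊆ S
    C⊆S {w} w∈C = closed-walk closed-S v∈S (walks w w∈C)
    fewer : ∣ S ∩ ∁ C ∣ < ∣ S ∣
    fewer rewrite ∣p∣≡∣p∩q∣+∣p∩∁q∣ S C =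
      m<n+m ∣ S ∩ ∁ C ∣ (≤-<-trans z≤n (x∈p⇒∣p-x∣<∣p∣ (x∈p∩q⁺ (v∈S , v∈C))))

  components : ComponentPartition ⊤
  components = partition ⊤ (On.wellFounded _ <-wellFounded ⊤) (λ _ _ _ _ → ∈⊤)

  closed-critical : ∀ {C u v} → Closed C → u ∈ C → v ∈ C →
    Exceeds e (α (spanning e)) u v → CriticalEdge (induced e C) u v
  closed-critical {C} {u} {v} closed u∈C v∈C (I , (_ , stable) , α<∣I∣) =
    critical-by-witness (induced e C) u v (I ∩ C) onC (+-<-cancel bound (α-max _ (I ∩ ∁ C) offC))
    where
    onC : Independent (deleteEdge (induced e C) u v) (I ∩ C)
    onC = p∩q⊆q I C , λ x y x∈ y∈ →
      ⊑-non-edge (delete-mono (spanning e) (induced e C) u v (induced-⊑ e {C})) x y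
                 (stable x y (p∩q⊆p I C x∈) (p∩q⊆p I C y∈))
    away : ∀ {x w} → x ∈ I ∩ ∁ C → w ∈ C → x ≢ w
    away x∈ w∈C refl = x∈∁p⇒x∉p (p∩q⊆q I _ x∈) w∈C
    offC : Independent (induced e (⊤ ∩ ∁ C)) (I ∩ ∁ C)
    offC = induced-independent⁺ e (λ x∈ → x∈p∩q⁺ (∈⊤ , p∩q⊆q I _ x∈)) λ x y x∈ y∈ →
      trans (sym (delete-away (spanning e) u v x y (away x∈ u∈C) (away x∈ v∈C)))
            (stable x y (p∩q⊆p I _ x∈) (p∩q⊆p I _ y∈))
    bound : α (induced e C) + α (induced e (⊤ ∩ ∁ C)) < ∣ I ∩ C ∣ + ∣ I ∩ ∁ C ∣
    bound = subst₂ _<_ (trans (α-spanning e) (α-split ⊤ C closed (λ _ → ∈⊤)))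
                       (∣p∣≡∣p∩q∣+∣p∩∁q∣ I C) α<∣I∣

module Pruning (G : Graph) where

  V : ℕ
  V = n G

  -- the invariant of the pruning: a symmetric spanning subgraph of G with α(G)
  Faithful : Edges V → Set
  Faithful e = SymmetricEdges e × e ⊑ adj G × α (spanning e) ≡ α (whole G)

  pruneAt : Fin V × Fin V → Edges V → Edges V
  pruneAt (u , v) e with e u v | α (spanning e) <? α (deleteEdge (spanning e) u v)
  ... | true | no _ = edge (deleteEdge (spanning e) u v)
  ... | _    | _    = e

  pruneAt-⊑ : ∀ p e → pruneAt p e ⊑ e
  pruneAt-⊑ (u , v) e with e u v | α (spanning e) <? α (deleteEdge (spanning e) u v)
  ... | true  | no _  = delete-⊑ (spanning e) u v
  ... | true  | yes _ = λ _ _ h → h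
  ... | false | _     = λ _ _ h → h

  pruneAt-faithful : ∀ p e → Faithful e → Faithful (pruneAt p e)
  pruneAt-faithful (u , v) e faithful@(sym-e , e⊑G , αe≡αG)
    with e u v | α (spanning e) <? α (deleteEdge (spanning e) u v)
  ... | true  | no ¬grows =
    delete-sym (spanning e) u v sym-e ,
    (λ x y h → e⊑G x y (delete-⊑ (spanning e) u v x y h)) ,
    trans (≤-antisym (≮⇒≥ ¬grows) (α-delete-≥ (spanning e) u v)) αe≡αG
  ... | true  | yes _ = faithful
  ... | false | _     = faithful

  -- If uv is still an edge of a later graph e′ ⊑ pruneAt (u , v) e, it was kept
  -- because deleting it increased α, and a largest independent set of e - uv
  -- stays independent in e′ - uv.
  pruneAt-exceeds : ∀ {u v} e → Faithful e → ∀ e′ → e′ ⊑ pruneAt (u , v) e → e′ u v ≡ true →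
    Exceeds e′ (α (whole G)) u v
  pruneAt-exceeds {u} {v} e (_ , _ , αe≡αG) e′ e′⊑ e′uv
    with e u v in euv | α (spanning e) <? α (deleteEdge (spanning e) u v)
  ... | true  | no _ = contradiction (trans (sym (e′⊑ u v e′uv)) (delete-removes (spanning e) u v)) λ ()
  ... | false | _    = contradiction (trans (sym (e′⊑ u v e′uv)) euv) λ ()
  ... | true  | yes grows with proj₁ (α-isAlpha (deleteEdge (spanning e) u v))
  ... | I , ind , ∣I∣≡α = exceeds-⊑ e′⊑ (I , ind , subst₂ _<_ αe≡αG (sym ∣I∣≡α) grows)

  prune : List (Fin V × Fin V) → Edges V → Edges V
  prune []       e = e
  prune (p ∷ ps) e = prune ps (pruneAt p e)

  prune-⊑ : ∀ ps e → prune ps e ⊑ e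
  prune-⊑ []       e x y h = h
  prune-⊑ (p ∷ ps) e x y h = pruneAt-⊑ p e x y (prune-⊑ ps (pruneAt p e) x y h)

  prune-faithful : ∀ ps e → Faithful e → Faithful (prune ps e)
  prune-faithful []       e faithful = faithful
  prune-faithful (p ∷ ps) e faithful = prune-faithful ps (pruneAt p e) (pruneAt-faithful p e faithful)

  prune-exceeds : ∀ ps e → Faithful e → ∀ {u v} → (u , v) ∈L ps → prune ps e u v ≡ true →
    Exceeds (prune ps e) (α (whole G)) u v
  prune-exceeds (p ∷ ps) e faithful (there uv∈ps) h =
    prune-exceeds ps (pruneAt p e) (pruneAt-faithful p e faithful) uv∈ps h
  prune-exceeds (_ ∷ ps) e faithful (here refl) h =
    pruneAt-exceeds e faithful (prune ps _) (prune-⊑ ps _) h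

  allPairs : List (Fin V × Fin V)
  allPairs = cartesianProduct (allFin V) (allFin V)

  H : Edges V
  H = prune allPairs (adj G)

  G-faithful : Faithful (adj G)
  G-faithful = Graph.sym G , (λ _ _ h → h) , refl

  H-faithful : Faithful H
  H-faithful = prune-faithful allPairs (adj G) G-faithful

  H-critical : ∀ u v → H u v ≡ true → Exceeds H (α (spanning H)) u v
  H-critical u v Huv = subst (λ a → Exceeds H a u v) (sym (proj₂ (proj₂ H-faithful)))
    (prune-exceeds allPairs (adj G) G-faithful (∈-cartesianProduct⁺ (∈-allFin u) (∈-allFin v)) Huv)

lemma4p1 : (G : Graph) → IndependencePacking G
lemma4p1 G = record
  { k         = k
  ; part      = λ i → induced H (part i)
  ; alphas    = λ i → α (induced H (part i))
  ; subgraph  = λ i → induced-isSubgraph G H sym-H H⊑G (part i)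
  ; disjoint  = disjoint
  ; covers    = λ v → covers v ∈⊤
  ; connected = λ i → rooted-connected (closed i) (proj₂ (rooted i))
  ; critical  = λ i u v uv∈ → let u∈ , v∈ , Huv = induced-edge⁻ H uv∈ in
                 closed-critical (closed i) u∈ v∈ (H-critical u v Huv)
  ; alpha-i   = λ i → α-isAlpha (induced H (part i))
  ; alpha-G   = subst (IsAlpha (whole G)) αG≡Σ (α-isAlpha (whole G))
  }
  where
  open Pruning G
  sym-H : SymmetricEdges H
  sym-H = proj₁ H-faithful
  H⊑G : H ⊑ adj G
  H⊑G = proj₁ (proj₂ H-faithful)
  open Components H sym-H
  open ComponentPartition components
  αG≡Σ : α (whole G) ≡ sum (tabulate λ i → α (induced H (part i)))
  αG≡Σ = trans (sym (proj₂ (proj₂ H-faithful))) (trans (α-spanning H) α-additive)
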